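{- For any integers $k \geq 2$, $M \geq 0$, and $0 \leq \alpha,\beta \leq M$, $$U^M_{k,(\alpha,\beta)}(t) = C_{k,(\alpha,\beta)}(t) - \frac{C_{k,(\alpha,M)}(t) \, C_{k,(M+1,\beta)}(t)}{1+C_{k,(M+1,M)}(t)}.$$
   Context: For an integer $k\ge 2$ and integers $\alpha,\beta, n\ge 0$, let $\mathcal{D}^k_{n,(\alpha,\beta)}$ be the set of integer lattice paths from $(0,\alpha)$ to $(kn+\beta-\alpha,\beta)$ using steps $U=(1,1)$ and $D=(1,1-k)$ that stay weakly above the line $y=0$ (such paths have exactly $n$ steps $D$; the empty path is included when $n=0$, $\alpha=\beta$), $C^k_{n,(\alpha,\beta)}=|\mathcal{D}^k_{n,(\alpha,\beta)}|$ and $C_{k,(\alpha,\beta)}(t)=\sum_{n\ge0}C^k_{n,(\alpha,\beta)}t^n$. For $M\ge0$ and $0\le\alpha,\beta\le M$, $U^{k,M}_{n,(\alpha,\beta)}$ is the number of paths in $\mathcal{D}^k_{n,(\alpha,\beta)}$ that stay weakly below the line $y=M$, and $U^M_{k,(\alpha,\beta)}(t)=\sum_{n\ge0}U^{k,M}_{n,(\alpha,\beta)}t^n$. -}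

module Defs where

open import Data.Nat as ℕ using (ℕ; zero; suc; _∸_)
open import Data.Integer as ℤ using (ℤ; +_; _≤_; -_)
import Data.Integer.Properties as ℤP
open import Data.List using (List; []; _∷_; length; filter; map; concatMap; foldr; upTo; reverse; zipWith; downFrom)
open import Data.List.Relation.Unary.All using (All; all?)
open import Data.Product using (_×_)
open import Relation.Binary.PropositionalEquality using (_≡_)
open import Relation.Nullary using (Dec)
open import Relation.Nullary.Decidable using (_×-dec_)
import Data.Nat.Properties as ℕP

-- Lattice paths with steps U = (1,1) and D = (1,1-k)

data Step : Set where
  U D : Step

δ : ℕ → Step → ℤ
δ k U = + 1
δ k D = + 1 ℤ.- + k

heights : ℕ → ℤ → List Step → List ℤ
heights k h []       = h ∷ []
heights k h (s ∷ ss) = h ∷ heights k (h ℤ.+ δ k s) ss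

endHeight : ℕ → ℤ → List Step → ℤ
endHeight k h []       = h
endHeight k h (s ∷ ss) = endHeight k (h ℤ.+ δ k s) ss

countD : List Step → ℕ
countD []       = 0
countD (U ∷ ss) = countD ss
countD (D ∷ ss) = suc (countD ss)

allLists : ℕ → List (List Step)
allLists zero    = [] ∷ []
allLists (suc L) = concatMap (λ p → (U ∷ p) ∷ (D ∷ p) ∷ []) (allLists L)

-- p ∈ D^k_{n,(α,β)} : start (0,α), exactly n D steps, end at height β,
-- weakly above y = 0.  (The horizontal endpoint kn+β-α is then forced; we
-- enumerate sequences of that length.)
IsDyck : ℕ → ℕ → ℕ → ℕ → List Step → Set
IsDyck k n α β p =
  (countD p ≡ n × endHeight k (+ α) p ≡ + β) × All (λ h → + 0 ≤ h) (heights k (+ α) p)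

isDyck? : ∀ k n α β p → Dec (IsDyck k n α β p)
isDyck? k n α β p =
  ((countD p ℕP.≟ n) ×-dec (endHeight k (+ α) p ℤP.≟ + β))
  ×-dec all? (λ h → + 0 ℤP.≤? h) (heights k (+ α) p)

IsBounded : ℕ → ℕ → ℕ → ℕ → ℕ → List Step → Set
IsBounded k M n α β p =
  IsDyck k n α β p × All (λ h → h ≤ + M) (heights k (+ α) p)

isBounded? : ∀ k M n α β p → Dec (IsBounded k M n α β p)
isBounded? k M n α β p =
  isDyck? k n α β p ×-dec all? (λ h → h ℤP.≤? + M) (heights k (+ α) p)

Ccount : ℕ → ℕ → ℕ → ℕ → ℕ
Ccount k n α β = length (filter (isDyck? k n α β) (allLists (k ℕ.* n ℕ.+ β ∸ α)))

Ucount : ℕ → ℕ → ℕ → ℕ → ℕ → ℕ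
Ucount k M n α β = length (filter (isBounded? k M n α β) (allLists (k ℕ.* n ℕ.+ β ∸ α)))

FPS : Set
FPS = ℕ → ℤ

sumℤ : List ℤ → ℤ
sumℤ = foldr ℤ._+_ (+ 0)

_⊕_ : FPS → FPS → FPS
(f ⊕ g) n = f n ℤ.+ g n

_⊖_ : FPS → FPS → FPS
(f ⊖ g) n = f n ℤ.- g n

_⊛_ : FPS → FPS → FPS
(f ⊛ g) n = sumℤ (map (λ i → f i ℤ.* g (n ∸ i)) (upTo (suc n)))

one : FPS
one zero    = + 1
one (suc n) = + 0

-- Coefficients [g_n , g_{n-1} , … , g_0] of the multiplicative inverse g
-- of a series f with constant term 1:
--   g_0 = 1,   g_{n+1} = - Σ_{i=1}^{n+1} f_i g_{n+1-i}.
invRev : FPS → ℕ → List ℤ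
invRev f zero    = + 1 ∷ []
invRev f (suc n) =
  (- sumℤ (zipWith ℤ._*_ (map (λ i → f (suc i)) (upTo (suc n))) (invRev f n)))
  ∷ invRev f n

headOr0 : List ℤ → ℤ
headOr0 []      = + 0
headOr0 (x ∷ _) = x

inv : FPS → FPS
inv f n = headOr0 (invRev f n)

Cgf : ℕ → ℕ → ℕ → FPS
Cgf k α β n = + Ccount k n α β

Ugf : ℕ → ℕ → ℕ → ℕ → FPS
Ugf k M α β n = + Ucount k M n α β

-- A path from α to β that leaves the strip 0 ≤ y ≤ M does so for the first time by a U-step
-- from height M to M + 1, since D-steps go down.  Cutting it there gives the first-passage
-- decomposition C_{α,β} = U_{α,β} + U_{α,M} C_{M+1,β}.  For β = M it reads
-- C_{α,M} = U_{α,M} (1 + C_{M+1,M}), and eliminating U_{α,M} yields the formula.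

module Submission where

open import Defs
open import Data.Bool using (true; false; if_then_else_)
open import Data.Integer as ℤ using (ℤ; +_; +≤+)
import Data.Integer.Properties as ℤP
open import Data.Integer.Tactic.RingSolver using (solve-∀)
open import Data.List using (List; []; _∷_; length; filter; concatMap; map; applyUpTo; downFrom; zipWith)
open import Data.List.Properties using (map-applyUpTo; filter-≐; filter-none; filter-accept; filter-reject)
open import Data.List.Relation.Unary.All as All using (All; []; _∷_; all?)
open import Data.Nat as ℕ using (ℕ; zero; suc; pred; _∸_; _≤_; _<_; _≤?_; z≤n; s≤s)
import Data.Nat.Properties as ℕP
open import Data.Product using (_×_; _,_; proj₁; proj₂)
open import Data.Sum using (_⊎_; inj₁; inj₂)
open import Function using (id; _∘_)
open import Level using (0ℓ)
open import Relation.Nullary using (¬_; Dec; yes; no; does; contradiction)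
open import Relation.Nullary.Decidable using (_×-dec_; dec-true; dec-false)
open import Relation.Unary using (Pred; Decidable; _≐_)
open import Relation.Binary.PropositionalEquality
open ≡-Reasoning
open import Algebra.Properties.CommutativeSemigroup ℤP.+-commutativeSemigroup
  using (interchange; x∙yz≈y∙xz)
open import Algebra.Properties.AbelianGroup ℤP.+-0-abelianGroup using (//-rightDividesʳ)

module PowerSeries where

  open import Data.Integer using (_+_; _*_; -_)

  0ₛ : FPS
  0ₛ _ = + 0

  tail : FPS → FPS
  tail f n = f (suc n)

  -- multiplication by the formal variable
  shift : FPS → FPS
  shift f zero    = + 0
  shift f (suc n) = f n

  infixl 7 _∗_

  _∗_ : FPS → FPS → FPS
  (f ∗ g) zero    = f 0 * g 0
  (f ∗ g) (suc n) = f 0 * g (suc n) + (tail f ∗ g) n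

  ∗-cong : ∀ {f f′ g g′} → f ≗ f′ → g ≗ g′ → f ∗ g ≗ f′ ∗ g′
  ∗-cong f≗f′ g≗g′ zero    = cong₂ _*_ (f≗f′ 0) (g≗g′ 0)
  ∗-cong f≗f′ g≗g′ (suc n) =
    cong₂ _+_ (cong₂ _*_ (f≗f′ 0) (g≗g′ (suc n))) (∗-cong (λ i → f≗f′ (suc i)) g≗g′ n)

  ∗-distribʳ-⊕ : ∀ f g h → (f ⊕ g) ∗ h ≗ (f ∗ h) ⊕ (g ∗ h)
  ∗-distribʳ-⊕ f g h zero    = ℤP.*-distribʳ-+ (h 0) (f 0) (g 0)
  ∗-distribʳ-⊕ f g h (suc n) = begin
    (f 0 + g 0) * h (suc n) + ((tail f ⊕ tail g) ∗ h) n
      ≡⟨ cong₂ _+_ (ℤP.*-distribʳ-+ (h (suc n)) (f 0) (g 0)) (∗-distribʳ-⊕ (tail f) (tail g) h n) ⟩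
    (f 0 * h (suc n) + g 0 * h (suc n)) + ((tail f ∗ h) n + (tail g ∗ h) n)
      ≡⟨ interchange (f 0 * h (suc n)) (g 0 * h (suc n)) _ _ ⟩
    (f 0 * h (suc n) + (tail f ∗ h) n) + (g 0 * h (suc n) + (tail g ∗ h) n) ∎

  ∗-scaleˡ : ∀ c f g → (λ i → c * f i) ∗ g ≗ (λ i → c * (f ∗ g) i)
  ∗-scaleˡ c f g zero    = ℤP.*-assoc c (f 0) (g 0)
  ∗-scaleˡ c f g (suc n) = begin
    c * f 0 * g (suc n) + ((λ i → c * tail f i) ∗ g) n
      ≡⟨ cong₂ _+_ (ℤP.*-assoc c (f 0) (g (suc n))) (∗-scaleˡ c (tail f) g n) ⟩
    c * (f 0 * g (suc n)) + c * (tail f ∗ g) n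
      ≡⟨ ℤP.*-distribˡ-+ c _ _ ⟨
    c * (f 0 * g (suc n) + (tail f ∗ g) n) ∎

  ∗-unfoldʳ : ∀ f g n → (f ∗ g) (suc n) ≡ f (suc n) * g 0 + (f ∗ tail g) n
  ∗-unfoldʳ f g zero    = ℤP.+-comm (f 0 * g 1) (f 1 * g 0)
  ∗-unfoldʳ f g (suc n) = begin
    f 0 * g (2 ℕ.+ n) + (tail f ∗ g) (suc n)
      ≡⟨ cong (λ x → f 0 * g (2 ℕ.+ n) + x) (∗-unfoldʳ (tail f) g n) ⟩
    f 0 * g (2 ℕ.+ n) + (f (2 ℕ.+ n) * g 0 + (tail f ∗ tail g) n)
      ≡⟨ x∙yz≈y∙xz (f 0 * g (2 ℕ.+ n)) (f (2 ℕ.+ n) * g 0) _ ⟩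
    f (2 ℕ.+ n) * g 0 + (f 0 * g (2 ℕ.+ n) + (tail f ∗ tail g) n) ∎

  ∗-comm : ∀ f g → f ∗ g ≗ g ∗ f
  ∗-comm f g zero    = ℤP.*-comm (f 0) (g 0)
  ∗-comm f g (suc n) = begin
    f 0 * g (suc n) + (tail f ∗ g) n ≡⟨ cong₂ _+_ (ℤP.*-comm (f 0) (g (suc n))) (∗-comm (tail f) g n) ⟩
    g (suc n) * f 0 + (g ∗ tail f) n ≡⟨ ∗-unfoldʳ g f n ⟨
    (g ∗ f) (suc n)                  ∎

  ∗-assoc : ∀ f g h → (f ∗ g) ∗ h ≗ f ∗ (g ∗ h)
  ∗-assoc f g h zero    = ℤP.*-assoc (f 0) (g 0) (h 0)
  ∗-assoc f g h (suc n) = begin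
    f 0 * g 0 * h (suc n) + (((λ i → f 0 * tail g i) ⊕ (tail f ∗ g)) ∗ h) n
      ≡⟨ cong (λ x → f 0 * g 0 * h (suc n) + x)
              (∗-distribʳ-⊕ (λ i → f 0 * tail g i) (tail f ∗ g) h n) ⟩
    f 0 * g 0 * h (suc n) + (((λ i → f 0 * tail g i) ∗ h) n + ((tail f ∗ g) ∗ h) n)
      ≡⟨ cong₂ (λ a b → f 0 * g 0 * h (suc n) + (a + b)) (∗-scaleˡ (f 0) (tail g) h n)
                                                           (∗-assoc (tail f) g h n) ⟩
    f 0 * g 0 * h (suc n) + (f 0 * (tail g ∗ h) n + (tail f ∗ (g ∗ h)) n)
      ≡⟨ regroup (f 0) (g 0) (h (suc n)) ((tail g ∗ h) n) ((tail f ∗ (g ∗ h)) n) ⟩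
    f 0 * (g ∗ h) (suc n) + (tail f ∗ (g ∗ h)) n ∎
    where
    regroup : ∀ a b c x y → a * b * c + (a * x + y) ≡ a * (b * c + x) + y
    regroup = solve-∀

  ∗-identityʳ : ∀ f → f ∗ one ≗ f
  ∗-identityʳ f zero    = ℤP.*-identityʳ (f 0)
  ∗-identityʳ f (suc n) = begin
    f 0 * + 0 + (tail f ∗ one) n ≡⟨ cong₂ _+_ (ℤP.*-zeroʳ (f 0)) (∗-identityʳ (tail f) n) ⟩
    + 0 + f (suc n)              ≡⟨ ℤP.+-identityˡ (f (suc n)) ⟩
    f (suc n)                    ∎

  ∗-identityˡ : ∀ f → one ∗ f ≗ f
  ∗-identityˡ f n = trans (∗-comm one f n) (∗-identityʳ f n)

  ∗-distribˡ-⊕ : ∀ f g h → f ∗ (g ⊕ h) ≗ (f ∗ g) ⊕ (f ∗ h)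
  ∗-distribˡ-⊕ f g h n = begin
    (f ∗ (g ⊕ h)) n           ≡⟨ ∗-comm f (g ⊕ h) n ⟩
    ((g ⊕ h) ∗ f) n           ≡⟨ ∗-distribʳ-⊕ g h f n ⟩
    (g ∗ f) n + (h ∗ f) n     ≡⟨ cong₂ _+_ (∗-comm g f n) (∗-comm h f n) ⟩
    (f ∗ g) n + (f ∗ h) n     ∎

  ∗-zeroˡ : ∀ g → 0ₛ ∗ g ≗ 0ₛ
  ∗-zeroˡ g zero    = ℤP.*-zeroˡ (g 0)
  ∗-zeroˡ g (suc n) = cong₂ _+_ (ℤP.*-zeroˡ (g (suc n))) (∗-zeroˡ g n)

  ∗-shiftˡ : ∀ f g → shift f ∗ g ≗ shift (f ∗ g)
  ∗-shiftˡ f g zero    = ℤP.*-zeroˡ (g 0)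
  ∗-shiftˡ f g (suc n) = trans (cong (_+ (f ∗ g) n) (ℤP.*-zeroˡ (g (suc n)))) (ℤP.+-identityˡ _)

  ∗-vanishesʳ : ∀ f g n → (∀ j → j ≤ n → g j ≡ + 0) → (f ∗ g) n ≡ + 0
  ∗-vanishesʳ f g zero    g≡0 = trans (cong (f 0 *_) (g≡0 0 z≤n)) (ℤP.*-zeroʳ (f 0))
  ∗-vanishesʳ f g (suc n) g≡0 = cong₂ _+_
    (trans (cong (f 0 *_) (g≡0 (suc n) ℕP.≤-refl)) (ℤP.*-zeroʳ (f 0)))
    (∗-vanishesʳ (tail f) g n (λ j j≤n → g≡0 j (ℕP.m≤n⇒m≤1+n j≤n)))

  ⊛≗∗ : ∀ f g → f ⊛ g ≗ f ∗ g
  ⊛≗∗ f g n =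
    trans (cong sumℤ (map-applyUpTo id (λ i → f i * g (n ∸ i)) (suc n))) (sum≡∗ f g n)
    where
    sum≡∗ : ∀ f g n → sumℤ (applyUpTo (λ i → f i * g (n ∸ i)) (suc n)) ≡ (f ∗ g) n
    sum≡∗ f g zero    = ℤP.+-identityʳ (f 0 * g 0)
    sum≡∗ f g (suc n) = cong (λ x → f 0 * g (suc n) + x) (sum≡∗ (tail f) g n)

  inv-suc : ∀ f n → inv f (suc n) ≡ - (tail f ∗ inv f) n
  inv-suc f n = cong -_ (begin
    sumℤ (zipWith _*_ (map (λ i → f (suc i)) (applyUpTo id (suc n))) (invRev f n))
      ≡⟨ cong₂ (λ as bs → sumℤ (zipWith _*_ as bs))
               (map-applyUpTo id (λ i → f (suc i)) (suc n)) (invRev≡ n) ⟩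
    sumℤ (zipWith _*_ (applyUpTo (tail f) (suc n)) (map (inv f) (downFrom (suc n))))
      ≡⟨ sum-zip≡∗ (tail f) n ⟩
    (tail f ∗ inv f) n ∎)
    where
    invRev≡ : ∀ n → invRev f n ≡ map (inv f) (downFrom (suc n))
    invRev≡ zero    = refl
    invRev≡ (suc n) = cong (inv f (suc n) ∷_) (invRev≡ n)
    sum-zip≡∗ : ∀ g n →
                sumℤ (zipWith _*_ (applyUpTo g (suc n)) (map (inv f) (downFrom (suc n)))) ≡ (g ∗ inv f) n
    sum-zip≡∗ g zero    = ℤP.+-identityʳ (g 0 * inv f 0)
    sum-zip≡∗ g (suc n) = cong (λ x → g 0 * inv f (suc n) + x) (sum-zip≡∗ (tail g) n)

  ∗-inverseʳ : ∀ f → f 0 ≡ + 1 → f ∗ inv f ≗ one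
  ∗-inverseʳ f f₀≡1 zero    = cong (_* + 1) f₀≡1
  ∗-inverseʳ f f₀≡1 (suc n) = begin
    f 0 * inv f (suc n) + (tail f ∗ inv f) n
      ≡⟨ cong₂ (λ a b → a * b + (tail f ∗ inv f) n) f₀≡1 (inv-suc f n) ⟩
    + 1 * - (tail f ∗ inv f) n + (tail f ∗ inv f) n
      ≡⟨ cong (_+ (tail f ∗ inv f) n) (ℤP.*-identityˡ (- (tail f ∗ inv f) n)) ⟩
    - (tail f ∗ inv f) n + (tail f ∗ inv f) n  ≡⟨ ℤP.+-inverseˡ ((tail f ∗ inv f) n) ⟩
    + 0                                        ∎

  ∗-inv-cancel : ∀ f w g → w 0 ≡ + 1 → ((f ∗ w) ∗ g) ∗ inv w ≗ f ∗ g
  ∗-inv-cancel f w g w₀≡1 n = begin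
    (((f ∗ w) ∗ g) ∗ inv w) n   ≡⟨ ∗-cong (∗-assoc f w g) (λ _ → refl) n ⟩
    ((f ∗ (w ∗ g)) ∗ inv w) n   ≡⟨ ∗-assoc f (w ∗ g) (inv w) n ⟩
    (f ∗ ((w ∗ g) ∗ inv w)) n   ≡⟨ ∗-cong (λ _ → refl) g∗w∗w⁻¹ n ⟩
    (f ∗ g) n                   ∎
    where
    g∗w∗w⁻¹ : (w ∗ g) ∗ inv w ≗ g
    g∗w∗w⁻¹ i = begin
      ((w ∗ g) ∗ inv w) i   ≡⟨ ∗-cong (∗-comm w g) (λ _ → refl) i ⟩
      ((g ∗ w) ∗ inv w) i   ≡⟨ ∗-assoc g w (inv w) i ⟩
      (g ∗ (w ∗ inv w)) i   ≡⟨ ∗-cong (λ _ → refl) (∗-inverseʳ w w₀≡1) i ⟩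
      (g ∗ one) i           ≡⟨ ∗-identityʳ g i ⟩
      g i                   ∎

open PowerSeries

module FilterCounting where

  open import Data.Nat using (_+_)

  length-filter-concatMap-pair : ∀ {a b p} {A : Set a} {B : Set b} {P : Pred B p}
    (P? : Decidable P) (f g : A → B) (xs : List A) →
    length (filter P? (concatMap (λ x → f x ∷ g x ∷ []) xs))
      ≡ length (filter (P? ∘ f) xs) + length (filter (P? ∘ g) xs)
  length-filter-concatMap-pair P? f g []       = refl
  length-filter-concatMap-pair P? f g (x ∷ xs) with does (P? (f x))
  ... | true  with does (P? (g x))
  ...   | true  = cong suc (trans (cong suc (length-filter-concatMap-pair P? f g xs))
                                  (sym (ℕP.+-suc _ _)))
  ...   | false = cong suc (length-filter-concatMap-pair P? f g xs)
  length-filter-concatMap-pair P? f g (x ∷ xs) | false with does (P? (g x))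
  ...   | true  = trans (cong suc (length-filter-concatMap-pair P? f g xs)) (sym (ℕP.+-suc _ _))
  ...   | false = length-filter-concatMap-pair P? f g xs

  length-filter-none : ∀ {a p} {A : Set a} {P : Pred A p} (P? : Decidable P) →
                       (∀ x → ¬ P x) → ∀ xs → length (filter P? xs) ≡ 0
  length-filter-none P? ¬P xs = cong length (filter-none P? (All.universal ¬P xs))

  length-filter-≐ : ∀ {a p r} {A : Set a} {P : Pred A p} {R : Pred A r}
                    (P? : Decidable P) (R? : Decidable R) →
                    P ≐ R → ∀ xs → length (filter P? xs) ≡ length (filter R? xs)
  length-filter-≐ P? R? P≐R xs = cong length (filter-≐ P? R? P≐R xs)

open FilterCounting

module LatticePaths (k : ℕ) where

  open import Data.Nat using (_+_; _*_)

  -- A first D-step from height h lands at h + 1 - k and uses up one of the D-steps.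
  afterDown : (ℕ → FPS) → ℕ → FPS
  afterDown F h with k ≤? suc h
  ... | yes _ = shift (F (suc h ∸ k))
  ... | no  _ = 0ₛ

  afterDown-zero : ∀ F h → afterDown F h 0 ≡ + 0
  afterDown-zero F h with k ≤? suc h
  ... | yes _ = refl
  ... | no  _ = refl

  afterDown-∗ : ∀ F g h → afterDown F h ∗ g ≗ afterDown (λ h′ → F h′ ∗ g) h
  afterDown-∗ F g h with k ≤? suc h
  ... | yes _ = ∗-shiftˡ (F (suc h ∸ k)) g
  ... | no  _ = ∗-zeroˡ g

  length-after-down : ∀ {h} n t → k ≤ suc h → k * suc n + t ∸ suc h ≡ k * n + t ∸ (suc h ∸ k)
  length-after-down {h} n t k≤1+h = begin
    k * suc n + t ∸ suc h
      ≡⟨ cong₂ _∸_ (trans (cong (_+ t) (ℕP.*-suc k n)) (ℕP.+-assoc k (k * n) t))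
                   (sym (ℕP.m+[n∸m]≡n k≤1+h)) ⟩
    k + (k * n + t) ∸ (k + (suc h ∸ k))
      ≡⟨ ℕP.[m+n]∸[m+o]≡n∸o k (k * n + t) (suc h ∸ k) ⟩
    k * n + t ∸ (suc h ∸ k) ∎

  height-after-U : ∀ h → + h ℤ.+ δ k U ≡ + suc h
  height-after-U h = cong +_ (ℕP.+-comm h 1)

  height-after-D : ∀ h → + h ℤ.+ δ k D ≡ + suc h ℤ.- + k
  height-after-D h = trans (assoc (+ h) (+ 1) (+ k)) (cong (ℤ._- + k) (height-after-U h))
    where
    assoc : ∀ a b c → a ℤ.+ (b ℤ.- c) ≡ a ℤ.+ b ℤ.- c
    assoc = solve-∀

  height-after-D-≥ : ∀ {h} → k ≤ suc h → + h ℤ.+ δ k D ≡ + (suc h ∸ k)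
  height-after-D-≥ {h} k≤1+h =
    trans (height-after-D h) (trans (ℤP.[+m]-[+n]≡m⊖n (suc h) k) (ℤP.⊖-≥ k≤1+h))

  height-after-D-nonneg : ∀ {h} → + 0 ℤ.≤ + h ℤ.+ δ k D → k ≤ suc h
  height-after-D-nonneg {h} 0≤ =
    ℤP.drop‿+≤+ (ℤP.0≤i-j⇒j≤i (subst (+ 0 ℤ.≤_) (height-after-D h) 0≤))

  nonneg? : Decidable (+ 0 ℤ.≤_)
  nonneg? y = + 0 ℤP.≤? y

  InWindow : ℕ → Pred ℤ 0ℓ
  InWindow M y = + 0 ℤ.≤ y × y ℤ.≤ + M

  inWindow? : ∀ M → Decidable (InWindow M)
  inWindow? M y = (+ 0 ℤP.≤? y) ×-dec (y ℤP.≤? + M)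

  -- walks L h: the series, by number of D-steps, of the step sequences of length L from height h
  -- to height t whose heights all satisfy Q.  A path from h with n D-steps has length k n + t - h;
  -- when this is negative the truncated subtraction gives length 0, where the count is 0 as well.
  module Counting {ℓ} {Q : Pred ℤ ℓ} (Q? : Decidable Q) (t : ℕ) where

    walks : ℕ → ℕ → FPS
    walks zero    h = if does (Q? (+ h) ×-dec h ℕ.≟ t) then one else 0ₛ
    walks (suc L) h = if does (Q? (+ h)) then (walks L (suc h) ⊕ afterDown (walks L) h) else 0ₛ

    paths : ℕ → FPS
    paths h n = walks (k * n + t ∸ h) h n

    walks-blocked : ∀ {h} → ¬ Q (+ h) → ∀ L → walks L h ≗ 0ₛ
    walks-blocked {h} ¬q zero    n with Q? (+ h)
    ... | yes q = contradiction q ¬q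
    ... | no  _ = refl
    walks-blocked {h} ¬q (suc L) n with Q? (+ h)
    ... | yes q = contradiction q ¬q
    ... | no  _ = refl

    walks-step : ∀ {h} → Q (+ h) → ∀ L → walks (suc L) h ≗ walks L (suc h) ⊕ afterDown (walks L) h
    walks-step {h} q L n with Q? (+ h)
    ... | yes _ = refl
    ... | no ¬q = contradiction q ¬q

    walks₀≗ : ∀ {h b} → does (Q? (+ h) ×-dec h ℕ.≟ t) ≡ b → walks 0 h ≗ (if b then one else 0ₛ)
    walks₀≗ eq n = cong (λ b → (if b then one else 0ₛ) n) eq

    walks₀-off : ∀ {h} → h ≢ t → walks 0 h ≗ 0ₛ
    walks₀-off {h} h≢t = walks₀≗ (dec-false (Q? (+ h) ×-dec h ℕ.≟ t) (h≢t ∘ proj₂))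

    walks₀-target : Q (+ t) → walks 0 t ≗ one
    walks₀-target q = walks₀≗ (dec-true (Q? (+ t) ×-dec t ℕ.≟ t) (q , refl))

    walks₀-suc : ∀ h n → walks 0 h (suc n) ≡ + 0
    walks₀-suc h n = one-or-0ₛ (does (Q? (+ h) ×-dec h ℕ.≟ t))
      where
      one-or-0ₛ : ∀ b → (if b then one else 0ₛ) (suc n) ≡ + 0
      one-or-0ₛ true  = refl
      one-or-0ₛ false = refl

    paths-blocked : ∀ {h} → ¬ Q (+ h) → paths h ≗ 0ₛ
    paths-blocked {h} ¬q n = walks-blocked ¬q (k * n + t ∸ h) n

    paths-short : ∀ {h n} → k * n + t ≤ h → paths h n ≡ walks 0 h n
    paths-short {h} {n} len≤h = cong (λ L → walks L h n) (ℕP.m≤n⇒m∸n≡0 len≤h)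

    paths-unreachable : ∀ {h n} → k * n + t < h → paths h n ≡ + 0
    paths-unreachable {h} {n} len<h = trans (paths-short (ℕP.<⇒≤ len<h))
      (walks₀-off (ℕP.>⇒≢ (ℕP.≤-<-trans (ℕP.m≤n+m t (k * n)) len<h)) n)

    paths-step : ∀ {h n} → h < k * n + t → Q (+ h) →
                 paths h n ≡ paths (suc h) n ℤ.+ afterDown paths h n
    paths-step {h} {n} h<len q = begin
      walks (k * n + t ∸ h) h n                     ≡⟨ cong (λ L → walks L h n) (ℕP.+-∸-assoc 1 h<len) ⟩
      walks (suc L) h n                             ≡⟨ walks-step q L n ⟩
      paths (suc h) n ℤ.+ afterDown (walks L) h n   ≡⟨ cong (λ x → paths (suc h) n ℤ.+ x) (after n) ⟩
      paths (suc h) n ℤ.+ afterDown paths h n       ∎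
      where
      L = k * n + t ∸ suc h
      after : ∀ n → afterDown (walks (k * n + t ∸ suc h)) h n ≡ afterDown paths h n
      after n with k ≤? suc h
      after zero     | yes _     = refl
      after (suc n′) | yes k≤1+h = cong (λ L → walks L (suc h ∸ k) n′) (length-after-down n′ t k≤1+h)
      after n        | no  _     = refl

    paths-unfold : 1 ≤ k → ∀ {h} → h ≤ t → Q (+ h) →
                   paths h ≗ (walks 0 h ⊕ paths (suc h)) ⊕ afterDown paths h
    paths-unfold 1≤k {h} h≤t q n = unfold n (h ℕ.≟ t)
      where
      k*0+t≡t : k * 0 + t ≡ t
      k*0+t≡t = cong (_+ t) (ℕP.*-zeroʳ k)

      unfold-by-step : ∀ {n} → h < k * n + t → walks 0 h n ≡ + 0 →
                       paths h n ≡ walks 0 h n ℤ.+ paths (suc h) n ℤ.+ afterDown paths h n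
      unfold-by-step {n} h<len walks₀≡0 = begin
        paths h n                                           ≡⟨ paths-step h<len q ⟩
        paths (suc h) n ℤ.+ afterDown paths h n
          ≡⟨ cong (ℤ._+ afterDown paths h n) (ℤP.+-identityˡ (paths (suc h) n)) ⟨
        + 0 ℤ.+ paths (suc h) n ℤ.+ afterDown paths h n
          ≡⟨ cong (λ x → x ℤ.+ paths (suc h) n ℤ.+ afterDown paths h n) walks₀≡0 ⟨
        walks 0 h n ℤ.+ paths (suc h) n ℤ.+ afterDown paths h n ∎

      unfold : ∀ n → Dec (h ≡ t) → paths h n ≡ walks 0 h n ℤ.+ paths (suc h) n ℤ.+ afterDown paths h n
      unfold (suc m) _         = unfold-by-step
        (ℕP.≤-<-trans h≤t (ℕP.m<n+m t (ℕP.≤-trans 1≤k (ℕP.m≤m*n k (suc m))))) (walks₀-suc h m)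
      unfold zero    (no h≢t)  = unfold-by-step
        (subst (h <_) (sym k*0+t≡t) (ℕP.≤∧≢⇒< h≤t h≢t)) (walks₀-off h≢t 0)
      unfold zero    (yes h≡t) = begin
        paths h 0                                           ≡⟨ paths-short (ℕP.≤-reflexive k*0+t≡h) ⟩
        walks 0 h 0                                         ≡⟨ trans (ℤP.+-identityʳ _) (ℤP.+-identityʳ _) ⟨
        walks 0 h 0 ℤ.+ + 0 ℤ.+ + 0
          ≡⟨ cong₂ (λ a b → walks 0 h 0 ℤ.+ a ℤ.+ b)
                   (paths-unreachable (ℕP.≤-reflexive (cong suc k*0+t≡h))) (afterDown-zero paths h) ⟨
        walks 0 h 0 ℤ.+ paths (suc h) 0 ℤ.+ afterDown paths h 0 ∎
        where
        k*0+t≡h : k * 0 + t ≡ h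
        k*0+t≡h = trans k*0+t≡t (sym h≡t)

    IsPath : ℕ → ℤ → List Step → Set ℓ
    IsPath n x p = (countD p ≡ n × endHeight k x p ≡ + t) × All Q (heights k x p)

    isPath? : ∀ n x → Decidable (IsPath n x)
    isPath? n x p = ((countD p ℕP.≟ n) ×-dec (endHeight k x p ℤP.≟ + t)) ×-dec all? Q? (heights k x p)

    IsPath-resp : ∀ {n x y p} → x ≡ y → IsPath n x p → IsPath n y p
    IsPath-resp {n} {p = p} = subst (λ x → IsPath n x p)

    start-allowed : ∀ {n x} p → IsPath n x p → Q x
    start-allowed []      (_ , qx ∷ _) = qx
    start-allowed (_ ∷ _) (_ , qx ∷ _) = qx

    IsPath-U : ∀ {n h} → Q (+ h) → (λ p → IsPath n (+ h) (U ∷ p)) ≐ IsPath n (+ suc h)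
    IsPath-U {n} {h} q =
        (λ { (ce , _ ∷ a) → IsPath-resp (height-after-U h) (ce , a) })
      , (λ path → let (ce , a) = IsPath-resp (sym (height-after-U h)) path in ce , q ∷ a)

    IsPath-D : ∀ {n h} → Q (+ h) → k ≤ suc h →
               (λ p → IsPath (suc n) (+ h) (D ∷ p)) ≐ IsPath n (+ (suc h ∸ k))
    IsPath-D {n} {h} q k≤1+h =
        (λ { ((c , e) , _ ∷ a) → IsPath-resp (height-after-D-≥ k≤1+h) ((ℕP.suc-injective c , e) , a) })
      , (λ path → let ((c , e) , a) = IsPath-resp (sym (height-after-D-≥ k≤1+h)) path
                  in (cong suc c , e) , q ∷ a)

    IsPath-D-zero : ∀ {x} p → ¬ IsPath 0 x (D ∷ p)
    IsPath-D-zero _ ((c , _) , _) = ℕP.1+n≢0 c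

    IsPath-D-below : (∀ {y} → Q y → + 0 ℤ.≤ y) →
                     ∀ {n h} → ¬ k ≤ suc h → ∀ p → ¬ IsPath (suc n) (+ h) (D ∷ p)
    IsPath-D-below Q⇒0≤ k≰1+h p ((c , e) , _ ∷ a) =
      k≰1+h (height-after-D-nonneg (Q⇒0≤ (start-allowed p ((ℕP.suc-injective c , e) , a))))

    empty-rejected : ∀ n x → ¬ IsPath n x [] → + length (filter (isPath? n x) ([] ∷ [])) ≡ + 0
    empty-rejected n x = cong (+_ ∘ length) ∘ filter-reject (isPath? n x) {x = []} {xs = []}

    count-empty : ∀ h n → + length (filter (isPath? n (+ h)) ([] ∷ [])) ≡ walks 0 h n
    count-empty h n with h ℕ.≟ t
    ... | no h≢t   = trans (empty-rejected n (+ h) λ ((_ , e) , _) → h≢t (ℤP.+-injective e))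
                         (sym (walks₀-off h≢t n))
    ... | yes refl = at-target (Q? (+ t)) n
      where
      at-target : Dec (Q (+ t)) → ∀ n → + length (filter (isPath? n (+ t)) ([] ∷ [])) ≡ walks 0 t n
      at-target (no ¬q) n       = trans (empty-rejected n (+ t) (¬q ∘ start-allowed []))
                                        (sym (walks-blocked ¬q 0 n))
      at-target (yes q) (suc m) = trans (empty-rejected (suc m) (+ t) λ ((c , _) , _) → ℕP.0≢1+n c)
                                        (sym (walks₀-suc t m))
      at-target (yes q) zero    =
        trans (cong (+_ ∘ length) (filter-accept (isPath? 0 (+ t)) {x = []} {xs = []} ((refl , refl) , q ∷ [])))
              (sym (walks₀-target q 0))

    count≡walks : (∀ {y} → Q y → + 0 ℤ.≤ y) →
                  ∀ L h n → + length (filter (isPath? n (+ h)) (allLists L)) ≡ walks L h n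
    count≡walks Q⇒0≤ zero    h n = count-empty h n
    count≡walks Q⇒0≤ (suc L) h n with Q? (+ h)
    ... | no ¬q = cong +_ (length-filter-none _ (λ p → ¬q ∘ start-allowed p) (allLists (suc L)))
    ... | yes q = begin
      + length (filter (isPath? n (+ h)) (allLists (suc L)))
        ≡⟨ cong +_ (length-filter-concatMap-pair (isPath? n (+ h)) (U ∷_) (D ∷_) (allLists L)) ⟩
      count (isPath? n (+ h) ∘ (U ∷_)) ℤ.+ count (isPath? n (+ h) ∘ (D ∷_))
        ≡⟨ cong₂ ℤ._+_ (trans (cong +_ (length-filter-≐ _ _ (IsPath-U q) (allLists L)))
                              (count≡walks Q⇒0≤ L (suc h) n))
                       (count-D n) ⟩
      walks L (suc h) n ℤ.+ afterDown (walks L) h n ∎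
      where
      count : ∀ {P : Pred (List Step) ℓ} → Decidable P → ℤ
      count P? = + length (filter P? (allLists L))

      count-D : ∀ n → count (isPath? n (+ h) ∘ (D ∷_)) ≡ afterDown (walks L) h n
      count-D n with k ≤? suc h
      count-D zero     | yes _     = cong +_ (length-filter-none _ IsPath-D-zero (allLists L))
      count-D zero     | no  _     = cong +_ (length-filter-none _ IsPath-D-zero (allLists L))
      count-D (suc n′) | yes k≤1+h = trans (cong +_ (length-filter-≐ _ _ (IsPath-D q k≤1+h) (allLists L)))
                                           (count≡walks Q⇒0≤ L (suc h ∸ k) n′)
      count-D (suc n′) | no  k≰1+h = cong +_ (length-filter-none _ (IsPath-D-below Q⇒0≤ k≰1+h) (allLists L))

  open Counting using (paths; count≡walks; isPath?)

  Cgf≡paths : ∀ α t n → Cgf k α t n ≡ paths nonneg? t α n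
  Cgf≡paths α t n = count≡walks nonneg? t id (k * n + t ∸ α) α n

  Cgf-unreachable : ∀ {h t n} → k * n + t < h → Cgf k h t n ≡ + 0
  Cgf-unreachable {h} {t} {n} len<h = trans (Cgf≡paths h t n) (Counting.paths-unreachable nonneg? t len<h)

  Ugf≡paths : ∀ M α t n → Ugf k M α t n ≡ paths (inWindow? M) t α n
  Ugf≡paths M α t n = trans
    (cong +_ (length-filter-≐ (isBounded? k M n α t) (isPath? (inWindow? M) t n (+ α)) bounded≐window
                              (allLists (k * n + t ∸ α))))
    (count≡walks (inWindow? M) t proj₁ (k * n + t ∸ α) α n)
    where
    bounded≐window : IsBounded k M n α t ≐ Counting.IsPath (inWindow? M) t n (+ α)
    bounded≐window = (λ ((ce , 0≤) , ≤M) → ce , All.zip (0≤ , ≤M))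
                   , (λ (ce , inside) → let (0≤ , ≤M) = All.unzip inside in (ce , 0≤) , ≤M)

module FirstPassage (k M β : ℕ) (1≤k : 1 ≤ k) (β≤M : β ≤ M) where

  open import Data.Integer using (_+_)
  open import Data.Nat using (_*_)
  open LatticePaths k

  module C  = Counting nonneg? β
  module B  = Counting (inWindow? M) β
  module Bᴹ = Counting (inWindow? M) M

  C⁺ : FPS
  C⁺ = C.paths (suc M)

  inside : ∀ {h} → h ≤ M → InWindow M (+ h)
  inside h≤M = +≤+ z≤n , +≤+ h≤M

  above : ¬ InWindow M (+ suc M)
  above (_ , +≤+ 1+M≤M) = ℕP.1+n≰n 1+M≤M

  C⁺-vanishes : ∀ {h n} → k * n ℕ.+ β ≤ h → h ≤ M → ∀ j → j ≤ n → C⁺ j ≡ + 0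
  C⁺-vanishes len≤h h≤M j j≤n = C.paths-unreachable
    (s≤s (ℕP.≤-trans (ℕP.+-monoˡ-≤ β (ℕP.*-monoʳ-≤ k j≤n)) (ℕP.≤-trans len≤h h≤M)))

  by-length : ∀ L h n → h ≤ M → k * n ℕ.+ β ∸ h ≡ L →
              C.paths h n ≡ B.paths h n + (Bᴹ.paths h ∗ C⁺) n
  by-length zero h n h≤M len≡0 = begin
    C.paths h n                        ≡⟨ C.paths-short len≤h ⟩
    C.walks 0 h n                      ≡⟨ empty-walks (h ℕ.≟ β) ⟩
    B.walks 0 h n                      ≡⟨ B.paths-short len≤h ⟨
    B.paths h n                        ≡⟨ ℤP.+-identityʳ (B.paths h n) ⟨
    B.paths h n + + 0
      ≡⟨ cong (λ x → B.paths h n + x) (∗-vanishesʳ (Bᴹ.paths h) C⁺ n (C⁺-vanishes len≤h h≤M)) ⟨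
    B.paths h n + (Bᴹ.paths h ∗ C⁺) n  ∎
    where
    len≤h = ℕP.m∸n≡0⇒m≤n len≡0
    empty-walks : Dec (h ≡ β) → C.walks 0 h n ≡ B.walks 0 h n
    empty-walks (yes refl) = trans (C.walks₀-target (+≤+ z≤n) n) (sym (B.walks₀-target (inside β≤M) n))
    empty-walks (no h≢β)   = trans (C.walks₀-off h≢β n) (sym (B.walks₀-off h≢β n))
  by-length (suc L) h n h≤M len≡ = begin
    C.paths h n
      ≡⟨ C.paths-step h<len (+≤+ z≤n) ⟩
    C.paths (suc h) n + afterDown C.paths h n
      ≡⟨ cong₂ _+_ (via-U (ℕP.m≤n⇒m<n∨m≡n h≤M)) (via-D n len≡) ⟩
    (B.paths (suc h) n + (Bᴹ₀ ∗ C⁺) n) + (afterDown B.paths h n + afterDown Bᴹ∗C⁺ h n)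
      ≡⟨ interchange (B.paths (suc h) n) ((Bᴹ₀ ∗ C⁺) n) (afterDown B.paths h n) _ ⟩
    (B.paths (suc h) n + afterDown B.paths h n) + ((Bᴹ₀ ∗ C⁺) n + afterDown Bᴹ∗C⁺ h n)
      ≡⟨ cong₂ _+_ (B.paths-step h<len (inside h≤M))
                   (trans (∗-distribʳ-⊕ Bᴹ₀ (afterDown Bᴹ.paths h) C⁺ n)
                          (cong (λ x → (Bᴹ₀ ∗ C⁺) n + x) (afterDown-∗ Bᴹ.paths C⁺ h n))) ⟨
    B.paths h n + ((Bᴹ₀ ⊕ afterDown Bᴹ.paths h) ∗ C⁺) n
      ≡⟨ cong (λ x → B.paths h n + x)
              (∗-cong (Bᴹ.paths-unfold 1≤k h≤M (inside h≤M)) (λ _ → refl) n) ⟨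
    B.paths h n + (Bᴹ.paths h ∗ C⁺) n ∎
    where
    Bᴹ₀ = Bᴹ.walks 0 h ⊕ Bᴹ.paths (suc h)
    Bᴹ∗C⁺ = λ h′ → Bᴹ.paths h′ ∗ C⁺

    h<len : h < k * n ℕ.+ β
    h<len = ℕP.m∸n≢0⇒n<m (λ len≡0 → ℕP.1+n≢0 (trans (sym len≡) len≡0))

    shorter : ∀ {m} → k * m ℕ.+ β ∸ h ≡ suc L → k * m ℕ.+ β ∸ suc h ≡ L
    shorter len≡ = trans (sym (ℕP.pred[m∸n]≡m∸[1+n] _ h)) (cong pred len≡)

    via-U : h < M ⊎ h ≡ M → C.paths (suc h) n ≡ B.paths (suc h) n + (Bᴹ₀ ∗ C⁺) n
    via-U (inj₁ h<M) = begin
      C.paths (suc h) n                             ≡⟨ by-length L (suc h) n h<M (shorter len≡) ⟩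
      B.paths (suc h) n + (Bᴹ.paths (suc h) ∗ C⁺) n
        ≡⟨ cong (λ x → B.paths (suc h) n + x) (∗-cong no-empty-walk (λ _ → refl) n) ⟨
      B.paths (suc h) n + (Bᴹ₀ ∗ C⁺) n              ∎
      where
      no-empty-walk : Bᴹ₀ ≗ Bᴹ.paths (suc h)
      no-empty-walk i =
        trans (cong (_+ Bᴹ.paths (suc h) i) (Bᴹ.walks₀-off (ℕP.<⇒≢ h<M) i)) (ℤP.+-identityˡ _)
    -- The U-step from M is the first passage above M; only the empty walk from M to M precedes it.
    via-U (inj₂ refl) = begin
      C⁺ n                                          ≡⟨ ∗-identityˡ C⁺ n ⟨
      (one ∗ C⁺) n                                  ≡⟨ ∗-cong only-empty-walk (λ _ → refl) n ⟨
      (Bᴹ₀ ∗ C⁺) n                                  ≡⟨ ℤP.+-identityˡ _ ⟨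
      + 0 + (Bᴹ₀ ∗ C⁺) n
        ≡⟨ cong (_+ (Bᴹ₀ ∗ C⁺) n) (B.paths-blocked above n) ⟨
      B.paths (suc h) n + (Bᴹ₀ ∗ C⁺) n              ∎
      where
      only-empty-walk : Bᴹ₀ ≗ one
      only-empty-walk i =
        trans (cong₂ _+_ (Bᴹ.walks₀-target (inside ℕP.≤-refl) i) (Bᴹ.paths-blocked above i))
              (ℤP.+-identityʳ (one i))

    via-D : ∀ n → k * n ℕ.+ β ∸ h ≡ suc L →
            afterDown C.paths h n ≡ afterDown B.paths h n + afterDown Bᴹ∗C⁺ h n
    via-D zero     _    = trans (afterDown-zero C.paths h)
                                (sym (cong₂ _+_ (afterDown-zero B.paths h) (afterDown-zero Bᴹ∗C⁺ h)))
    via-D (suc n′) len≡ with k ≤? suc h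
    ... | yes k≤1+h = by-length L (suc h ∸ k) n′ (ℕP.≤-trans (ℕP.∸-monoʳ-≤ (suc h) 1≤k) h≤M)
                        (trans (sym (length-after-down n′ β k≤1+h)) (shorter len≡))
    ... | no  _     = refl

  first-passage : ∀ h → h ≤ M → C.paths h ≗ B.paths h ⊕ (Bᴹ.paths h ∗ C⁺)
  first-passage h h≤M n = by-length (k * n ℕ.+ β ∸ h) h n h≤M refl

open LatticePaths using (Cgf≡paths; Ugf≡paths; Cgf-unreachable)

first-passage-gf : ∀ k M {α β} → 1 ≤ k → α ≤ M → β ≤ M →
                   Cgf k α β ≗ Ugf k M α β ⊕ (Ugf k M α M ∗ Cgf k (suc M) β)
first-passage-gf k M {α} {β} 1≤k α≤M β≤M n = begin
  Cgf k α β n                              ≡⟨ Cgf≡paths k α β n ⟩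
  C.paths α n                              ≡⟨ first-passage α α≤M n ⟩
  B.paths α n ℤ.+ (Bᴹ.paths α ∗ C⁺) n
    ≡⟨ cong₂ ℤ._+_ (Ugf≡paths k M α β n) (∗-cong (Ugf≡paths k M α M) (Cgf≡paths k (suc M) β) n) ⟨
  Ugf k M α β n ℤ.+ (Ugf k M α M ∗ Cgf k (suc M) β) n ∎
  where open FirstPassage k M β 1≤k β≤M

Cgf-to-ceiling : ∀ k M {α} → 1 ≤ k → α ≤ M → Cgf k α M ≗ Ugf k M α M ∗ (one ⊕ Cgf k (suc M) M)
Cgf-to-ceiling k M {α} 1≤k α≤M n = begin
  Cgf k α M n                   ≡⟨ first-passage-gf k M 1≤k α≤M ℕP.≤-refl n ⟩
  X n ℤ.+ (X ∗ Y) n             ≡⟨ cong (ℤ._+ (X ∗ Y) n) (∗-identityʳ X n) ⟨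
  (X ∗ one) n ℤ.+ (X ∗ Y) n     ≡⟨ ∗-distribˡ-⊕ X one Y n ⟨
  (X ∗ (one ⊕ Y)) n             ∎
  where
  X = Ugf k M α M
  Y = Cgf k (suc M) M

theorem4p2 : (k M α β : ℕ) → 2 ≤ k → α ≤ M → β ≤ M →
    ∀ n → Ugf k M α β n
      ≡ (Cgf k α β ⊖ ((Cgf k α M ⊛ Cgf k (suc M) β) ⊛ inv (one ⊕ Cgf k (suc M) M))) n
theorem4p2 k M α β 2≤k α≤M β≤M n = begin
  Ugf k M α β n                                  ≡⟨ //-rightDividesʳ ((X ∗ Z) n) (Ugf k M α β n) ⟨
  Ugf k M α β n ℤ.+ (X ∗ Z) n ℤ.- (X ∗ Z) n
    ≡⟨ cong₂ ℤ._-_ (first-passage-gf k M 1≤k α≤M β≤M n) (cancel n) ⟨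
  (Cgf k α β ⊖ ((Cgf k α M ⊛ Z) ⊛ inv W)) n     ∎
  where
  1≤k = ℕP.≤-trans (ℕP.n≤1+n 1) 2≤k
  X = Ugf k M α M
  Z = Cgf k (suc M) β
  W = one ⊕ Cgf k (suc M) M

  W₀≡1 : W 0 ≡ + 1
  W₀≡1 = cong (λ y → + 1 ℤ.+ y)
              (Cgf-unreachable k (ℕP.≤-reflexive (cong (λ m → suc (m ℕ.+ M)) (ℕP.*-zeroʳ k))))

  cancel : (Cgf k α M ⊛ Z) ⊛ inv W ≗ X ∗ Z
  cancel i = begin
    ((Cgf k α M ⊛ Z) ⊛ inv W) i   ≡⟨ ⊛≗∗ (Cgf k α M ⊛ Z) (inv W) i ⟩
    ((Cgf k α M ⊛ Z) ∗ inv W) i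
      ≡⟨ ∗-cong (λ j → trans (⊛≗∗ (Cgf k α M) Z j)
                             (∗-cong (Cgf-to-ceiling k M 1≤k α≤M) (λ _ → refl) j))
                (λ _ → refl) i ⟩
    (((X ∗ W) ∗ Z) ∗ inv W) i     ≡⟨ ∗-inv-cancel X W Z W₀≡1 i ⟩
    (X ∗ Z) i                     ∎
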